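{- Let $\lambda \geq 5$ and let $G \in ER(n,d,\lambda)$ have a uniform shared neighborhood structure isomorphic to the path $P_\lambda$. Let $u \sim v$ in $G$ with $N(u)\cap N(v) = \{w_1,\dots,w_\lambda\}$, where $w_1$ is an endpoint of the path $G[N(u)\cap N(v)]$. If $w_1 \sim w_2$, then $N(w_1)\cap N(w_2)$ contains exactly one vertex from $N(u)\setminus (N(v)\cup\{v\})$ and exactly one vertex from $N(v)\setminus(N(u)\cup\{u\})$.
   Context: For a finite simple graph $G$, $N(u)$ is the open neighborhood of a vertex $u$. $G \in ER(n,d,\lambda)$ means $G$ has $n$ vertices, is $d$-regular, and every pair of adjacent vertices has exactly $\lambda$ common neighbors. $G$ has a uniform shared neighborhood structure isomorphic to $H$ if the induced subgraph $G[N(u)\cap N(v)]$ is isomorphic to $H$ for all adjacent $u,v$. $P_m$ is the path graph on $m$ vertices. -}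

module Defs where

open import Data.Nat using (ℕ; zero; suc; _+_; _≤_)
open import Data.Fin using (Fin; toℕ)
open import Data.Bool using (Bool; true; false; _∧_; not)
open import Data.List using (List; length; filter; allFin)
open import Data.Product using (Σ; _×_; _,_; ∃)
open import Relation.Binary.PropositionalEquality using (_≡_)
open import Relation.Nullary using (¬_)
open import Relation.Nullary.Decidable using (does)
open import Function.Definitions using (Injective)
open import Function.Bundles using (_⇔_)

record Graph (n : ℕ) : Set where
  field
    adj   : Fin n → Fin n → Bool
    sym   : ∀ u v → adj u v ≡ adj v u
    irref : ∀ u → adj u u ≡ false

module _ {n : ℕ} (G : Graph n) where
  open Graph G

  _∼_ : Fin n → Fin n → Set
  u ∼ v = adj u v ≡ true

  count : (Fin n → Bool) → ℕ
  count P = length (filter (λ x → Data.Bool._≟_ (P x) true) (allFin n))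

  common : Fin n → Fin n → Fin n → Bool
  common u v w = adj u w ∧ adj v w

  degree : Fin n → ℕ
  degree u = count (adj u)

  -- G ∈ ER(n,d,λ): d-regular, and adjacent vertices have exactly λ common neighbours
  -- (the vertex count n is the index of the graph)
  IsER : ℕ → ℕ → Set
  IsER d l = (∀ u → degree u ≡ d)
           × (∀ u v → u ∼ v → count (common u v) ≡ l)

pathAdj : {m : ℕ} → Fin m → Fin m → Set
pathAdj i j = (suc (toℕ i) ≡ toℕ j) Data.Sum.⊎ (suc (toℕ j) ≡ toℕ i)
  where import Data.Sum

module _ {n : ℕ} (G : Graph n) where

  -- G[N(u) ∩ N(v)] ≅ P_m : an injective map f : Fin m → Fin n whose image is
  -- exactly N(u) ∩ N(v) and which preserves and reflects adjacency.
  SharedNbhdIsoPath : ℕ → Fin n → Fin n → Set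
  SharedNbhdIsoPath m u v =
    Σ (Fin m → Fin n) λ f →
        Injective _≡_ _≡_ f
      × (∀ w → common G u v w ≡ true ⇔ ∃ λ i → f i ≡ w)
      × (∀ i j → _∼_ G (f i) (f j) ⇔ pathAdj i j)

  UniformSharedPath : ℕ → Set
  UniformSharedPath m = ∀ u v → _∼_ G u v → SharedNbhdIsoPath m u v

-- Pass from the edge uv to the edge uw₁. Its shared neighbourhood is again a path P_λ,
-- and it contains v and w₂ as adjacent vertices. A neighbour of v on this path lies in
-- N(u) ∩ N(v) and is adjacent to w₁, so it is w₂: v is an endpoint of the path, with
-- neighbour w₂. Since λ ≥ 3, w₂ has exactly one further neighbour x on the path, and x
-- is the vertex sought; it is not adjacent to v because the only neighbour of v on the
-- path is w₂. Exchanging u and v gives the second count.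
module Submission where

open import Defs
open import Data.Nat using (ℕ; suc; _≤_; s≤s)
open import Data.Nat.Properties using (suc-injective; m+1+n≢n; m+n≤o⇒n≤o)
open import Data.Fin using (Fin; zero; suc; toℕ; inject₁; _≟_)
open import Data.Fin.Properties using (toℕ-injective; toℕ-inject₁)
open import Data.Bool using (Bool; true; false; _∧_; not)
open import Data.Bool.Properties using (¬-not)
import Data.Bool as Bool
open import Data.List using (List; []; _∷_; length; filter; allFin)
open import Data.List.Membership.Propositional using (_∈_)
open import Data.List.Membership.Propositional.Properties using (∈-allFin; ∈-filter⁺; ∈-filter⁻)
open import Data.List.Relation.Unary.Any using (here; there)
open import Data.List.Relation.Unary.All using (_∷_)
open import Data.List.Relation.Unary.AllPairs using (_∷_)
open import Data.List.Relation.Unary.Unique.Propositional using (Unique)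
open import Data.List.Relation.Unary.Unique.Propositional.Properties using (allFin⁺; filter⁺)
open import Data.Product using (_×_; _,_; proj₁; proj₂; ∃; ∃!)
open import Data.Sum using (_⊎_; inj₁; inj₂; swap)
open import Data.Empty using (⊥-elim)
open import Function using (_∘_)
open import Function.Bundles using (Equivalence; _⇔_; mk⇔)
open import Relation.Nullary using (¬_; Dec)
open import Relation.Nullary.Decidable using (does; dec-true; dec-false)
open import Relation.Binary.PropositionalEquality using (_≡_; _≢_; refl; sym; trans; cong; subst)

open Equivalence using (to; from)

∧-intro : ∀ {a b} → a ≡ true → b ≡ true → a ∧ b ≡ true
∧-intro refl refl = refl

∧-elim : ∀ a {b} → a ∧ b ≡ true → a ≡ true × b ≡ true
∧-elim true b≡true = refl , b≡true

≢true⇒not≡true : ∀ {a} → a ≢ true → not a ≡ true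
≢true⇒not≡true a≢true = cong not (¬-not a≢true)

not≡true⇒≢true : ∀ {a} → not a ≡ true → a ≢ true
not≡true⇒≢true {false} _ ()

length≡1⁺ : ∀ {A : Set} {xs : List A} {x : A} →
            Unique xs → x ∈ xs → (∀ {y} → y ∈ xs → x ≡ y) → length xs ≡ 1
length≡1⁺ {xs = _ ∷ []}    _                 _ _       = refl
length≡1⁺ {xs = _ ∷ _ ∷ _} ((a≢b ∷ _) ∷ _) _ x≡all =
  ⊥-elim (a≢b (trans (sym (x≡all (here refl))) (x≡all (there (here refl)))))

length≡1⁻ : ∀ {A : Set} {xs : List A} {x y : A} → length xs ≡ 1 → x ∈ xs → y ∈ xs → x ≡ y
length≡1⁻ {xs = _ ∷ []} refl (here refl) (here refl) = refl

module _ {n : ℕ} (G : Graph n) {P : Fin n → Bool} where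

  private
    P? : (x : Fin n) → Dec (P x ≡ true)
    P? x = P x Bool.≟ true

    ∈-selected : ∀ {x} → P x ≡ true → x ∈ filter P? (allFin n)
    ∈-selected {x} = ∈-filter⁺ P? (∈-allFin x)

  count≡1⁺ : ∃! _≡_ (λ x → P x ≡ true) → count G P ≡ 1
  count≡1⁺ (x , Px , x≡all) =
    length≡1⁺ (filter⁺ P? (allFin⁺ n)) (∈-selected Px) (x≡all ∘ proj₂ ∘ ∈-filter⁻ P? {xs = allFin n})

  count≡1⁻ : count G P ≡ 1 → ∀ {x y} → P x ≡ true → P y ≡ true → x ≡ y
  count≡1⁻ count≡1 Px Py = length≡1⁻ count≡1 (∈-selected Px) (∈-selected Py)

module _ {m : ℕ} where

  pathAdj-sym : {i j : Fin m} → pathAdj i j → pathAdj j i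
  pathAdj-sym = swap

  private
    above-unique : {j a b : Fin m} → suc (toℕ j) ≡ toℕ a → suc (toℕ j) ≡ toℕ b → a ≡ b
    above-unique a↑ b↑ = toℕ-injective (trans (sym a↑) b↑)

    below-unique : {j a b : Fin m} → suc (toℕ a) ≡ toℕ j → suc (toℕ b) ≡ toℕ j → a ≡ b
    below-unique a↓ b↓ = toℕ-injective (suc-injective (trans a↓ (sym b↓)))

  pathAdj-other-neighbour-unique : {i j a b : Fin m} → pathAdj j i → pathAdj j a → pathAdj j b →
                                   a ≢ i → b ≢ i → a ≡ b
  pathAdj-other-neighbour-unique (inj₁ i↑) (inj₁ a↑) _         a≢i _   = ⊥-elim (a≢i (above-unique a↑ i↑))
  pathAdj-other-neighbour-unique (inj₁ i↑) (inj₂ _)  (inj₁ b↑) _   b≢i = ⊥-elim (b≢i (above-unique b↑ i↑))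
  pathAdj-other-neighbour-unique (inj₁ _)  (inj₂ a↓) (inj₂ b↓) _   _   = below-unique a↓ b↓
  pathAdj-other-neighbour-unique (inj₂ _)  (inj₁ a↑) (inj₁ b↑) _   _   = above-unique a↑ b↑
  pathAdj-other-neighbour-unique (inj₂ i↓) (inj₁ _)  (inj₂ b↓) _   b≢i = ⊥-elim (b≢i (below-unique b↓ i↓))
  pathAdj-other-neighbour-unique (inj₂ i↓) (inj₂ a↓) _         a≢i _   = ⊥-elim (a≢i (below-unique a↓ i↓))

private
  edge-extends-upward : ∀ {m} → 3 ≤ m → {i j : Fin m} → suc (toℕ i) ≡ toℕ j →
                        (∃ λ k → pathAdj i k × k ≢ j) ⊎ (∃ λ k → pathAdj j k × k ≢ i)
  edge-extends-upward (s≤s (s≤s (s≤s _))) {zero} j≡1 =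
    inj₂ (suc (suc zero) , inj₁ (sym (cong suc j≡1)) , λ ())
  edge-extends-upward _ {suc i} j≡i+2 =
    inj₁ (inject₁ i , inj₂ (cong suc (toℕ-inject₁ i)) ,
          λ k≡j → m+1+n≢n 1 (trans j≡i+2 (trans (cong toℕ (sym k≡j)) (toℕ-inject₁ i))))

pathAdj-edge-extends : ∀ {m} → 3 ≤ m → {i j : Fin m} → pathAdj i j →
                       (∃ λ k → pathAdj i k × k ≢ j) ⊎ (∃ λ k → pathAdj j k × k ≢ i)
pathAdj-edge-extends m≥3 (inj₁ i↑) = edge-extends-upward m≥3 i↑
pathAdj-edge-extends m≥3 (inj₂ j↑) = swap (edge-extends-upward m≥3 j↑)

pathAdj-endpoint-neighbour : ∀ {m} → 3 ≤ m → {i j : Fin m} → pathAdj i j →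
                             (∀ {k} → pathAdj i k → k ≡ j) → ∃ λ k → pathAdj j k × k ≢ i
pathAdj-endpoint-neighbour m≥3 i-j i-endpoint with pathAdj-edge-extends m≥3 i-j
... | inj₁ (k , i-k , k≢j) = ⊥-elim (k≢j (i-endpoint i-k))
... | inj₂ next            = next

module _ {n : ℕ} (G : Graph n) where
  open Graph G using (adj; irref)

  ∼-sym : ∀ {u v} → _∼_ G u v → _∼_ G v u
  ∼-sym {u} {v} u∼v = trans (Graph.sym G v u) u∼v

  shared-path-endpoint-next : ∀ {m a b p q} → 3 ≤ m → SharedNbhdIsoPath G m a b →
    common G a b p ≡ true → common G a b q ≡ true → _∼_ G p q →
    (∀ {y} → common G a b y ≡ true → _∼_ G p y → y ≡ q) →
    ∃! _≡_ (λ x → common G a b x ≡ true × _∼_ G q x × x ≢ p)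
  shared-path-endpoint-next {a = a} {b} m≥3 (f , f-inj , f-onto , f-adj) abp abq p∼q p-endpoint
    with to (f-onto _) abp | to (f-onto _) abq
  ... | i , refl | j , refl = extend (pathAdj-endpoint-neighbour m≥3 i-j i-endpoint)
    where
    in-ab : ∀ k → common G a b (f k) ≡ true
    in-ab k = from (f-onto (f k)) (k , refl)

    i-j : pathAdj i j
    i-j = to (f-adj i j) p∼q

    i-endpoint : ∀ {k} → pathAdj i k → k ≡ j
    i-endpoint i-k = f-inj (p-endpoint (in-ab _) (from (f-adj i _) i-k))

    extend : (∃ λ k → pathAdj j k × k ≢ i) →
             ∃! _≡_ (λ x → common G a b x ≡ true × _∼_ G (f j) x × x ≢ f i)
    extend (k , j-k , k≢i) = f k , (in-ab k , from (f-adj j k) j-k , k≢i ∘ f-inj) , unique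
      where
      unique : ∀ {y} → common G a b y ≡ true × _∼_ G (f j) y × y ≢ f i → f k ≡ y
      unique (aby , fj∼y , y≢fi) with to (f-onto _) aby
      ... | k′ , refl = cong f (pathAdj-other-neighbour-unique (pathAdj-sym i-j) j-k
                                  (to (f-adj j k′) fj∼y) k≢i (y≢fi ∘ cong f))

  ∼-irrefl : ∀ {u} → ¬ _∼_ G u u
  ∼-irrefl {u} u∼u with () ← trans (sym u∼u) (irref u)

  exclusiveCommonNbr : (u v w₁ w₂ : Fin n) → Fin n → Bool
  exclusiveCommonNbr u v w₁ w₂ x = common G w₁ w₂ x ∧ adj u x ∧ not (adj v x) ∧ not (does (x ≟ v))

  exclusiveCommonNbr≡true⇔ : ∀ {u v w₁ w₂ x} → exclusiveCommonNbr u v w₁ w₂ x ≡ true ⇔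
    ((_∼_ G w₁ x × _∼_ G w₂ x) × _∼_ G u x × ¬ _∼_ G v x × x ≢ v)
  exclusiveCommonNbr≡true⇔ {u} {v} {w₁} {w₂} {x} = mk⇔ split join
    where
    split : exclusiveCommonNbr u v w₁ w₂ x ≡ true →
            (_∼_ G w₁ x × _∼_ G w₂ x) × _∼_ G u x × ¬ _∼_ G v x × x ≢ v
    split P≡true =
      let w₁w₂x , rest  = ∧-elim (common G w₁ w₂ x) P≡true
          u∼x   , rest′ = ∧-elim (adj u x) rest
          v≁x   , x≉v   = ∧-elim (not (adj v x)) rest′
      in ∧-elim (adj w₁ x) w₁w₂x , u∼x , not≡true⇒≢true v≁x , not≡true⇒≢true x≉v ∘ dec-true (x ≟ v)

    join : (_∼_ G w₁ x × _∼_ G w₂ x) × _∼_ G u x × ¬ _∼_ G v x × x ≢ v →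
           exclusiveCommonNbr u v w₁ w₂ x ≡ true
    join ((w₁∼x , w₂∼x) , u∼x , v≁x , x≢v) =
      ∧-intro (∧-intro w₁∼x w₂∼x)
        (∧-intro u∼x (∧-intro (≢true⇒not≡true v≁x) (cong not (dec-false (x ≟ v) x≢v))))

  exclusiveCommonNbr-unique : ∀ {l u v w₁ w₂} → 3 ≤ l → UniformSharedPath G l →
    _∼_ G u v → _∼_ G u w₁ → _∼_ G v w₁ → _∼_ G u w₂ → _∼_ G v w₂ → _∼_ G w₁ w₂ →
    (∀ {y} → _∼_ G u y → _∼_ G v y → _∼_ G w₁ y → y ≡ w₂) →
    count G (exclusiveCommonNbr u v w₁ w₂) ≡ 1
  exclusiveCommonNbr-unique {u = u} {v} {w₁} {w₂} l≥3 shared u∼v u∼w₁ v∼w₁ u∼w₂ v∼w₂ w₁∼w₂ w₂-unique =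
    count≡1⁺ G (transfer (shared-path-endpoint-next l≥3 (shared u w₁ u∼w₁)
      (∧-intro u∼v (∼-sym v∼w₁)) (∧-intro u∼w₂ w₁∼w₂) v∼w₂ v-endpoint))
    where
    v-endpoint : ∀ {y} → common G u w₁ y ≡ true → _∼_ G v y → y ≡ w₂
    v-endpoint {y} uw₁y v∼y = let u∼y , w₁∼y = ∧-elim (adj u y) uw₁y in w₂-unique u∼y v∼y w₁∼y

    transfer : ∃! _≡_ (λ x → common G u w₁ x ≡ true × _∼_ G w₂ x × x ≢ v) →
               ∃! _≡_ (λ x → exclusiveCommonNbr u v w₁ w₂ x ≡ true)
    transfer (x , (uw₁x , w₂∼x , x≢v) , x-unique) =
      x , from exclusiveCommonNbr≡true⇔ ((w₁∼x , w₂∼x) , u∼x , v≁x , x≢v) , x-unique ∘ restrict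
      where
      u∼x = proj₁ (∧-elim (adj u x) uw₁x)
      w₁∼x = proj₂ (∧-elim (adj u x) uw₁x)

      v≁x : ¬ _∼_ G v x
      v≁x v∼x = ∼-irrefl (subst (_∼_ G w₂) (v-endpoint uw₁x v∼x) w₂∼x)

      restrict : ∀ {y} → exclusiveCommonNbr u v w₁ w₂ y ≡ true →
                 common G u w₁ y ≡ true × _∼_ G w₂ y × y ≢ v
      restrict P≡true with to exclusiveCommonNbr≡true⇔ P≡true
      ... | (w₁∼y , w₂∼y) , u∼y , _ , y≢v = ∧-intro u∼y w₁∼y , w₂∼y , y≢v

theorem4 : ∀ {n d l : ℕ} (G : Graph n) → 5 ≤ l → IsER G d l → UniformSharedPath G l →
  ∀ (u v w₁ w₂ : Fin n) → _∼_ G u v →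
  common G u v w₁ ≡ true → common G u v w₂ ≡ true →
  count G (λ w → common G u v w ∧ Graph.adj G w₁ w) ≡ 1 →
  _∼_ G w₁ w₂ →
  (count G (λ x → common G w₁ w₂ x ∧ Graph.adj G u x ∧ not (Graph.adj G v x) ∧ not (does (x ≟ v))) ≡ 1)
  × (count G (λ x → common G w₁ w₂ x ∧ Graph.adj G v x ∧ not (Graph.adj G u x) ∧ not (does (x ≟ u))) ≡ 1)
theorem4 G l≥5 _ shared u v w₁ w₂ u∼v uvw₁ uvw₂ w₁-endpoint w₁∼w₂ =
  exclusiveCommonNbr-unique G l≥3 shared u∼v u∼w₁ v∼w₁ u∼w₂ v∼w₂ w₁∼w₂ w₂-unique ,
  exclusiveCommonNbr-unique G l≥3 shared (∼-sym G u∼v) v∼w₁ u∼w₁ v∼w₂ u∼w₂ w₁∼w₂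
    (λ v∼y u∼y w₁∼y → w₂-unique u∼y v∼y w₁∼y)
  where
  l≥3 = m+n≤o⇒n≤o 2 l≥5

  u∼w₁ = proj₁ (∧-elim (Graph.adj G u w₁) uvw₁)
  v∼w₁ = proj₂ (∧-elim (Graph.adj G u w₁) uvw₁)
  u∼w₂ = proj₁ (∧-elim (Graph.adj G u w₂) uvw₂)
  v∼w₂ = proj₂ (∧-elim (Graph.adj G u w₂) uvw₂)

  w₂-unique : ∀ {y} → _∼_ G u y → _∼_ G v y → _∼_ G w₁ y → y ≡ w₂
  w₂-unique u∼y v∼y w₁∼y = count≡1⁻ G w₁-endpoint (∧-intro (∧-intro u∼y v∼y) w₁∼y) (∧-intro uvw₂ w₁∼w₂)
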